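{- Let $p$ be an odd prime. There exists an element $\pi=\pi_0+\pi_1i+\pi_2j+\pi_3k\in\mathcal P(p)$ with $\pi_0=0$ (equivalently, with $\bar\pi\notin\mathcal P(p)$) if and only if $p\equiv 3\pmod 8$.
   Context: $\mathbb H(\mathbb Z)$ denotes the Hamilton integral quaternions $a_0+a_1i+a_2j+a_3k$, $a_i\in\mathbb Z$, with $i^2=j^2=k^2=-1$, $k=ij=-ji$. The conjugate of $\alpha=a_0+a_1i+a_2j+a_3k$ is $\bar\alpha=a_0-a_1i-a_2j-a_3k$, its norm is $N(\alpha)=a_0^2+a_1^2+a_2^2+a_3^2$, and $\alpha$ is primitive if $\gcd(a_0,a_1,a_2,a_3)=1$. For an odd prime $p$: if $p\equiv 1\pmod 4$, $\mathcal P(p)$ is the set of primitive $\pi$ with $N(\pi)=p$, $\pi_0>0$ and $\pi-1\in2\mathbb H(\mathbb Z)$; if $p\equiv3\pmod4$, $\mathcal P(p)$ is the set of primitive $\pi$ with $N(\pi)=p$, such that $\pi_0>0$ if $\pi_0\neq0$, or $\pi_1>0$ if $\pi_0=0$, and $\pi-i-j-k\in2\mathbb H(\mathbb Z)$. -}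

module Defs where

open import Data.Nat as ℕ using (ℕ)
open import Data.Integer using (ℤ; +_; _+_; _-_; _*_; -_; 0ℤ; 1ℤ; _>_)
open import Data.Integer.GCD using (gcd)
open import Data.Integer.Divisibility using (_∣_)
open import Data.Nat.DivMod using (_%_)
open import Data.Product using (_×_)
open import Data.Sum using (_⊎_)
open import Relation.Binary.PropositionalEquality using (_≡_)

-- Hamilton integral quaternion a0 + a1 i + a2 j + a3 k, aᵢ ∈ ℤ
record HZ : Set where
  constructor quat
  field
    c0 c1 c2 c3 : ℤ
open HZ public

conj : HZ → HZ
conj (quat a b c d) = quat a (- b) (- c) (- d)

norm : HZ → ℤ
norm (quat a b c d) = a * a + b * b + c * c + d * d

Primitive : HZ → Set
Primitive (quat a b c d) = gcd (gcd (gcd a b) c) d ≡ 1ℤ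

_≡₂_ : HZ → HZ → Set
quat a b c d ≡₂ quat a' b' c' d' =
  ((+ 2) ∣ (a - a')) × ((+ 2) ∣ (b - b')) × ((+ 2) ∣ (c - c')) × ((+ 2) ∣ (d - d'))

one : HZ
one = quat 1ℤ 0ℤ 0ℤ 0ℤ

ijk : HZ
ijk = quat 0ℤ 1ℤ 1ℤ 1ℤ

InP : ℕ → HZ → Set
InP p π with p % 4
... | 1 = Primitive π × norm π ≡ + p × c0 π > 0ℤ × π ≡₂ one
... | 3 = Primitive π × norm π ≡ + p
          × ((c0 π > 0ℤ) ⊎ (c0 π ≡ 0ℤ × c1 π > 0ℤ))
          × π ≡₂ ijk
... | _ = Primitive π × norm π ≡ + p × c0 π > 0ℤ × π ≡₂ one

module Submission where

-- If π ∈ 𝒫(p) has π₀ = 0 then p % 4 ≡ 3, and π ≡ i + j + k (mod 2) makes π₁, π₂, π₃ odd, so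
-- p = π₁² + π₂² + π₃² ≡ 3 (mod 8).  Conversely let p = 8t + 3 and m = (p - 1)/2.  Gauss's
-- computation of 2ᵐ m! modulo p gives p ∣ 2ᵐ + 1, so x = 2^(2t+1) satisfies p ∣ x² + 2.  Thue's
-- lemma yields u, v with |u|, |v| < √p and p ∣ u + x v, hence p ∣ u² + 2v² < 3p, which leads to
-- p = a² + 2b²; reducing mod 8, a and b are odd and a i + b j + b k ∈ 𝒫(p).  Conjugation preserves
-- every condition defining 𝒫(p) except the sign condition, which fails for π̄ exactly when π₀ = 0.

open import Defs
open import Data.Nat using (ℕ)
open import Data.Nat.Primality using (Prime; prime[2]; prime⇒nonTrivial; prime⇒nonZero; prime⇒irreducible; euclidsLemma)
open import Data.Nat.DivMod using (_%_)
open import Data.Integer using (0ℤ)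
open import Data.Fin.Base as Fin using (Fin; toℕ; fromℕ<; remQuot; combine)
open import Data.Fin.Properties using (all?; pigeonhole; toℕ-injective; toℕ-fromℕ<; combine-remQuot; toℕ<n; <-irrefl)
open import Data.Product using (_×_; _,_; ∃-syntax; ∃₂; proj₁; proj₂; uncurry)
open import Data.Product.Properties using (×-≡,≡→≡)
open import Data.Sum using (_⊎_; inj₁; inj₂; reduce)
open import Function using (_∘_)
open import Function.Bundles using (_⇔_; mk⇔)
open import Relation.Binary.PropositionalEquality
open import Relation.Nullary using (¬_; contradiction; yes; no)
open import Relation.Nullary.Decidable using (toWitness; _×-dec_; _→-dec_)

module _ where
  open import Data.Nat.Base
  open import Data.Nat.Properties
  open import Data.Nat.DivMod
  open import Data.Nat.Divisibility
  open import Data.Nat.Tactic.RingSolver using (solve-∀)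
  open ≡-Reasoning

  at-residue-mod-8 : (P : ℕ → Set) → (∀ (r : Fin 8) → P (toℕ r)) → ∀ n → P (n % 8)
  at-residue-mod-8 P P-residue n = subst P (toℕ-fromℕ< (m%n<n n 8)) (P-residue (fromℕ< (m%n<n n 8)))

  n%8%2≡n%2 : ∀ n → n % 8 % 2 ≡ n % 2
  n%8%2≡n%2 n = m∣n⇒o%n%m≡o%m 2 8 n (divides 4 refl)

  2∣n⇒[1+n]%2≡1 : ∀ {n} → 2 ∣ n → suc n % 2 ≡ 1
  2∣n⇒[1+n]%2≡1 (divides k refl) = [m+kn]%n≡m%n 1 k 2

  n%2≡1⇒n*n%8≡1 : ∀ n → n % 2 ≡ 1 → n * n % 8 ≡ 1
  n%2≡1⇒n*n%8≡1 n n-odd = begin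
    n * n % 8             ≡⟨ %-distribˡ-* n n 8 ⟩
    n % 8 * (n % 8) % 8   ≡⟨ at-residue-mod-8 OddSquare odd-residues n (trans (n%8%2≡n%2 n) n-odd) ⟩
    1                     ∎
    where
    OddSquare : ℕ → Set
    OddSquare r = r % 2 ≡ 1 → r * r % 8 ≡ 1
    odd-residues : ∀ (r : Fin 8) → OddSquare (toℕ r)
    odd-residues = toWitness {a? = all? λ r → (toℕ r % 2 ≟ 1) →-dec (toℕ r * toℕ r % 8 ≟ 1)} _

  odd⇒[x²+y²+z²]%8≡3 : ∀ x y z → x % 2 ≡ 1 → y % 2 ≡ 1 → z % 2 ≡ 1 →
                                   (x * x + y * y + z * z) % 8 ≡ 3
  odd⇒[x²+y²+z²]%8≡3 x y z x-odd y-odd z-odd = begin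
    (x * x + y * y + z * z) % 8                     ≡⟨ %-distribˡ-+ (x * x + y * y) (z * z) 8 ⟩
    ((x * x + y * y) % 8 + z * z % 8) % 8           ≡⟨ cong (λ s → (s + z * z % 8) % 8) (%-distribˡ-+ (x * x) (y * y) 8) ⟩
    ((x * x % 8 + y * y % 8) % 8 + z * z % 8) % 8   ≡⟨ cong₂ (λ s t → ((s + t) % 8 + z * z % 8) % 8)
                                                          (n%2≡1⇒n*n%8≡1 x x-odd) (n%2≡1⇒n*n%8≡1 y y-odd) ⟩
    (2 + z * z % 8) % 8                             ≡⟨ cong (λ t → (2 + t) % 8) (n%2≡1⇒n*n%8≡1 z z-odd) ⟩
    3                                               ∎

  [a²+2b²]%8≡[[a%8]²+2[b%8]²]%8 : ∀ a b → (a * a + 2 * (b * b)) % 8 ≡ (a % 8 * (a % 8) + 2 * (b % 8 * (b % 8))) % 8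
  [a²+2b²]%8≡[[a%8]²+2[b%8]²]%8 a b = begin
    (a * a + 2 * (b * b)) % 8
      ≡⟨ cong₂ (λ a b → (a * a + 2 * (b * b)) % 8) (m≡m%n+[m/n]*n a 8) (m≡m%n+[m/n]*n b 8) ⟩
    ((r + x * 8) * (r + x * 8) + 2 * ((s + y * 8) * (s + y * 8))) % 8
      ≡⟨ cong (_% 8) (expand r x s y) ⟩
    (r * r + 2 * (s * s) + (2 * r * x + 8 * x * x + 4 * s * y + 16 * y * y) * 8) % 8
      ≡⟨ [m+kn]%n≡m%n (r * r + 2 * (s * s)) (2 * r * x + 8 * x * x + 4 * s * y + 16 * y * y) 8 ⟩
    (r * r + 2 * (s * s)) % 8 ∎
    where
    r s x y : ℕ
    r = a % 8
    s = b % 8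
    x = a / 8
    y = b / 8
    expand : ∀ r x s y → (r + x * 8) * (r + x * 8) + 2 * ((s + y * 8) * (s + y * 8))
                       ≡ r * r + 2 * (s * s) + (2 * r * x + 8 * x * x + 4 * s * y + 16 * y * y) * 8
    expand = solve-∀

  [a²+2b²]%8≡3⇒odd : ∀ a b → (a * a + 2 * (b * b)) % 8 ≡ 3 → a % 2 ≡ 1 × b % 2 ≡ 1
  [a²+2b²]%8≡3⇒odd a b ≡3 =
    let odd-a , odd-b = from-residues (trans (sym ([a²+2b²]%8≡[[a%8]²+2[b%8]²]%8 a b)) ≡3)
    in trans (sym (n%8%2≡n%2 a)) odd-a , trans (sym (n%8%2≡n%2 b)) odd-b
    where
    Both-odd : ℕ → ℕ → Set
    Both-odd r s = (r * r + 2 * (s * s)) % 8 ≡ 3 → r % 2 ≡ 1 × s % 2 ≡ 1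
    residues : ∀ (r s : Fin 8) → Both-odd (toℕ r) (toℕ s)
    residues = toWitness {a? = all? λ r → all? λ s →
      ((toℕ r * toℕ r + 2 * (toℕ s * toℕ s)) % 8 ≟ 3) →-dec ((toℕ r % 2 ≟ 1) ×-dec (toℕ s % 2 ≟ 1))} _
    from-residues : Both-odd (a % 8) (b % 8)
    from-residues = at-residue-mod-8 (Both-odd (a % 8))
                      (λ s → at-residue-mod-8 (λ r → Both-odd r (toℕ s)) (λ r → residues r s) a) b

  -- Representations by a² + 2b²

  a²+2b²≡2p⇒b²+2c²≡p : ∀ a b {p} → a * a + 2 * (b * b) ≡ 2 * p → ∃[ c ] b * b + 2 * (c * c) ≡ p
  a²+2b²≡2p⇒b²+2c²≡p a b {p} eq = c , *-cancelˡ-≡ _ p 2 (begin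
    2 * (b * b + 2 * (c * c))       ≡⟨ regroup c b ⟩
    c * 2 * (c * 2) + 2 * (b * b)   ≡⟨ cong (λ a → a * a + 2 * (b * b)) (_∣_.equality 2∣a) ⟨
    a * a + 2 * (b * b)             ≡⟨ eq ⟩
    2 * p                           ∎)
    where
    2∣a*a : 2 ∣ a * a
    2∣a*a = ∣m+n∣m⇒∣n (subst (2 ∣_) (trans (sym eq) (+-comm (a * a) _)) (m∣m*n p)) (m∣m*n (b * b))
    2∣a : 2 ∣ a
    2∣a = reduce (euclidsLemma a a prime[2] 2∣a*a)
    c : ℕ
    c = _∣_.quotient 2∣a
    regroup : ∀ c b → 2 * (b * b + 2 * (c * c)) ≡ c * 2 * (c * 2) + 2 * (b * b)
    regroup = solve-∀

  ∣∧<3*⇒≡∨≡2* : ∀ {p n} → p ∣ n → 0 < n → n < 3 * p → n ≡ p ⊎ n ≡ 2 * p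
  ∣∧<3*⇒≡∨≡2* (divides 0 refl) ()
  ∣∧<3*⇒≡∨≡2* {p} (divides 1 refl) _ _ = inj₁ (*-identityˡ p)
  ∣∧<3*⇒≡∨≡2* {p} (divides 2 refl) _ _ = inj₂ refl
  ∣∧<3*⇒≡∨≡2* {p} (divides (suc (suc (suc q))) refl) _ n<3p =
    contradiction (*-monoˡ-≤ p (s≤s (s≤s (s≤s (z≤n {q}))))) (<⇒≱ n<3p)

  floor-sqrt : ∀ n → ∃[ s ] s * s ≤ n × n < suc s * suc s
  floor-sqrt zero = 0 , z≤n , s≤s z≤n
  floor-sqrt (suc n) with floor-sqrt n
  ... | s , s²≤n , n<[1+s]² with suc n <? suc s * suc s
  ...   | yes 1+n<[1+s]² = s , m≤n⇒m≤1+n s²≤n , 1+n<[1+s]²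
  ...   | no  1+n≮[1+s]² = suc s , ≮⇒≥ 1+n≮[1+s]² , ≤-<-trans n<[1+s]² (*-mono-< (n<1+n (suc s)) (n<1+n (suc s)))

  prime⇒¬square : ∀ {p} s → Prime p → s * s ≢ p
  prime⇒¬square {p} s prime-p s²≡p with prime⇒irreducible prime-p (divides s (sym s²≡p))
  ... | inj₁ refl = contradiction (sym s²≡p) (nonTrivial⇒≢1 {{prime⇒nonTrivial prime-p}})
  ... | inj₂ refl = contradiction s²≡p
                      (>⇒≢ (m<m*n s s {{prime⇒nonZero prime-p}} (nonTrivial⇒n>1 s {{prime⇒nonTrivial prime-p}})))

  a²+2b²≡0⇒a≡0∧b≡0 : ∀ a b → a * a + 2 * (b * b) ≡ 0 → a ≡ 0 × b ≡ 0
  a²+2b²≡0⇒a≡0∧b≡0 zero    zero    _ = refl , refl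
  a²+2b²≡0⇒a≡0∧b≡0 zero    (suc b) ()
  a²+2b²≡0⇒a≡0∧b≡0 (suc a) b       ()

  small-multiple⇒p≡c²+2d² : ∀ {p s a b} → s * s < p → a ≤ s → b ≤ s →
                           p ∣ a * a + 2 * (b * b) → a * a + 2 * (b * b) ≢ 0 →
                           ∃[ c ] ∃[ d ] c * c + 2 * (d * d) ≡ p
  small-multiple⇒p≡c²+2d² {p} {s} {a} {b} s²<p a≤s b≤s p∣n n≢0 =
    from-multiple (∣∧<3*⇒≡∨≡2* p∣n (n≢0⇒n>0 n≢0) n<3p)
    where
    n<3p : a * a + 2 * (b * b) < 3 * p
    n<3p = ≤-<-trans (+-mono-≤ (*-mono-≤ a≤s a≤s) (*-monoʳ-≤ 2 (*-mono-≤ b≤s b≤s)))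
                     (subst (_< 3 * p) (three-squares s) (*-monoʳ-< 3 s²<p))
      where three-squares : ∀ s → 3 * (s * s) ≡ s * s + 2 * (s * s)
            three-squares = solve-∀
    from-multiple : a * a + 2 * (b * b) ≡ p ⊎ a * a + 2 * (b * b) ≡ 2 * p → ∃[ c ] ∃[ d ] c * c + 2 * (d * d) ≡ p
    from-multiple (inj₁ n≡p)  = a , b , n≡p
    from-multiple (inj₂ n≡2p) = b , a²+2b²≡2p⇒b²+2c²≡p a b n≡2p

module _ where
  open import Data.Integer.Base as ℤ using (ℤ; +_; -[1+_]; +[1+_]; 0ℤ; 1ℤ; -1ℤ; _+_; _-_; _*_; -_; _^_; _⊖_; _>_; _<_)
  import Data.Integer.Properties as ℤ
  open import Data.Integer.Divisibility.Signed
  import Data.Integer.DivMod as DM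
  import Data.Integer.Divisibility as Unsigned
  open import Data.Integer.Tactic.RingSolver using (solve-∀)
  import Data.Nat.Tactic.RingSolver as ℕ-Solver
  open import Data.Nat.Base as ℕ using (ℕ; zero; suc)
  import Data.Nat.Properties as ℕ
  import Data.Nat.Divisibility as ℕ
  import Data.Nat.GCD as ℕ
  open import Data.Nat.DivMod using (_%_; _/_; m≡m%n+[m/n]*n; m∣n⇒o%n%m≡o%m)
  open ≡-Reasoning

  -- Finite products and Gauss's lemma for 2

  ∏ : ℕ → (ℕ → ℤ) → ℤ
  ∏ zero    f = 1ℤ
  ∏ (suc n) f = f 0 * ∏ n (f ∘ suc)

  ∏-cong : ∀ n {f g : ℕ → ℤ} → (∀ k → f k ≡ g k) → ∏ n f ≡ ∏ n g
  ∏-cong zero    f≗g = refl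
  ∏-cong (suc n) f≗g = cong₂ _*_ (f≗g 0) (∏-cong n (f≗g ∘ suc))

  ∏-+ : ∀ m n f → ∏ (m ℕ.+ n) f ≡ ∏ m f * ∏ n (λ j → f (m ℕ.+ j))
  ∏-+ zero    n f = sym (ℤ.*-identityˡ _)
  ∏-+ (suc m) n f = trans (cong (f 0 *_) (∏-+ m n (f ∘ suc))) (sym (ℤ.*-assoc (f 0) _ _))

  ∏-* : ∀ n f g → ∏ n (λ k → f k * g k) ≡ ∏ n f * ∏ n g
  ∏-* zero    f g = refl
  ∏-* (suc n) f g = trans (cong (f 0 * g 0 *_) (∏-* n (f ∘ suc) (g ∘ suc))) (interchange (f 0) (g 0) _ _)
    where interchange : ∀ a b c d → a * b * (c * d) ≡ a * c * (b * d)
          interchange = solve-∀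

  ∏-const : ∀ n c → ∏ n (λ _ → c) ≡ c ^ n
  ∏-const zero    c = refl
  ∏-const (suc n) c = cong (c *_) (∏-const n c)

  ∏-cong-mod : ∀ {m} n {f g} → (∀ k → m ∣ f k - g k) → m ∣ ∏ n f - ∏ n g
  ∏-cong-mod zero    f≡g = divides 0ℤ refl
  ∏-cong-mod (suc n) {f} {g} f≡g = subst (_ ∣_) (sym (split (f 0) (g 0) (∏ n (f ∘ suc)) (∏ n (g ∘ suc))))
    (∣m∣n⇒∣m+n (∣m⇒∣m*n _ (f≡g 0)) (∣n⇒∣m*n (g 0) (∏-cong-mod n (f≡g ∘ suc))))
    where split : ∀ a b F G → a * F - b * G ≡ (a - b) * F + b * (F - G)
          split = solve-∀

  ∏-snoc : ∀ n f → ∏ (suc n) f ≡ ∏ n f * f n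
  ∏-snoc n f = begin
    ∏ (suc n) f              ≡⟨ cong (λ k → ∏ k f) (ℕ.+-comm 1 n) ⟩
    ∏ (n ℕ.+ 1) f            ≡⟨ ∏-+ n 1 f ⟩
    ∏ n f * (f (n ℕ.+ 0) * 1ℤ) ≡⟨ cong (λ x → ∏ n f * x) (trans (ℤ.*-identityʳ _) (cong f (ℕ.+-identityʳ n))) ⟩
    ∏ n f * f n              ∎

  prime-∣-* : ∀ {p} i j → Prime p → + p ∣ i * j → + p ∣ i ⊎ + p ∣ j
  prime-∣-* {p} i j prime-p p∣ij
    with euclidsLemma ℤ.∣ i ∣ ℤ.∣ j ∣ prime-p (subst (p ℕ.∣_) (ℤ.abs-* i j) (∣⇒∣ᵤ p∣ij))
  ... | inj₁ p∣i = inj₁ (∣ᵤ⇒∣ p∣i)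
  ... | inj₂ p∣j = inj₂ (∣ᵤ⇒∣ p∣j)

  prime∤∏ : ∀ {p} → Prime p → ∀ n f → (∀ k → k ℕ.< n → ¬ + p ∣ f k) → ¬ + p ∣ ∏ n f
  prime∤∏ prime-p zero    f p∤f p∣1 = ℕ.nonTrivial⇒≢1 {{prime⇒nonTrivial prime-p}} (ℕ.∣1⇒≡1 (∣⇒∣ᵤ p∣1))
  prime∤∏ prime-p (suc n) f p∤f p∣∏ with prime-∣-* (f 0) _ prime-p p∣∏
  ... | inj₁ p∣f0 = p∤f 0 (ℕ.s≤s ℕ.z≤n) p∣f0
  ... | inj₂ p∣∏′ = prime∤∏ prime-p n (f ∘ suc) (λ k k<n → p∤f (suc k) (ℕ.s≤s k<n)) p∣∏′

  factorial : ℕ → ℤ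
  factorial n = ∏ n (λ k → + suc k)

  prime∤factorial : ∀ {p} n → Prime p → n ℕ.< p → ¬ + p ∣ factorial n
  prime∤factorial n prime-p n<p = prime∤∏ prime-p n _
    (λ k k<n p∣k+1 → ℕ.>⇒∤ (ℕ.≤-<-trans k<n n<p) (∣⇒∣ᵤ p∣k+1))

  evens : ℕ → ℤ
  evens n = ∏ n (λ k → + 2 * + suc k)

  odd : ℕ → ℕ → ℤ
  odd n j = 1ℤ + + 2 * (n ⊖ j)

  odds : ℕ → ℤ
  odds n = ∏ (suc n) (odd n)

  factorial-suc : ∀ n → factorial (suc n) ≡ factorial n * + suc n
  factorial-suc n = ∏-snoc n _

  factorial-odd : ∀ n → factorial (suc (n ℕ.+ n)) ≡ evens n * odds n
  factorial-odd zero    = refl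
  factorial-odd (suc n) = begin
    factorial (suc (suc n ℕ.+ suc n))
      ≡⟨ cong (factorial ∘ suc ∘ suc) (ℕ.+-suc n n) ⟩
    factorial (suc (suc (suc (n ℕ.+ n))))
      ≡⟨ trans (factorial-suc (suc (suc (n ℕ.+ n))))
               (cong (_* + suc (suc (suc (n ℕ.+ n)))) (factorial-suc (suc (n ℕ.+ n)))) ⟩
    factorial (suc (n ℕ.+ n)) * + suc (suc (n ℕ.+ n)) * + suc (suc (suc (n ℕ.+ n)))
      ≡⟨ cong₂ (λ a b → factorial (suc (n ℕ.+ n)) * a * b) 2X 2X+1 ⟩
    factorial (suc (n ℕ.+ n)) * (X + X) * (1ℤ + (X + X))
      ≡⟨ cong (λ f → f * (X + X) * (1ℤ + (X + X))) (factorial-odd n) ⟩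
    evens n * odds n * (X + X) * (1ℤ + (X + X))
      ≡⟨ regroup (evens n) (odds n) X ⟩
    evens n * (+ 2 * X) * ((1ℤ + + 2 * X) * odds n)
      ≡⟨ cong₂ _*_ (∏-snoc n _) (cong ((1ℤ + + 2 * X) *_) (∏-cong (suc n) shift)) ⟨
    evens (suc n) * odds (suc n) ∎
    where
    X : ℤ
    X = + suc n
    2X : + suc (suc (n ℕ.+ n)) ≡ X + X
    2X = trans (cong (λ m → + suc m) (sym (ℕ.+-suc n n))) (ℤ.pos-+ (suc n) (suc n))
    2X+1 : + suc (suc (suc (n ℕ.+ n))) ≡ 1ℤ + (X + X)
    2X+1 = trans (ℤ.pos-+ 1 (suc (suc (n ℕ.+ n)))) (cong (λ x → 1ℤ + x) 2X)
    shift : ∀ j → odd (suc n) (suc j) ≡ odd n j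
    shift j = cong (λ d → 1ℤ + + 2 * d) (ℤ.[1+m]⊖[1+n]≡m⊖n n j)
    regroup : ∀ E O X → E * O * (X + X) * (1ℤ + (X + X)) ≡ E * (+ 2 * X) * ((1ℤ + + 2 * X) * O)
    regroup = solve-∀

  2[N+1+j]≡[4N+3]-odd : ∀ N j → + 2 * + suc (N ℕ.+ j) ≡ + (4 ℕ.* N ℕ.+ 3) - odd N j
  2[N+1+j]≡[4N+3]-odd N j = begin
    + 2 * + suc (N ℕ.+ j)                         ≡⟨ cong (+ 2 *_) (trans (ℤ.pos-+ 1 (N ℕ.+ j))
                                                                      (cong (λ x → 1ℤ + x) (ℤ.pos-+ N j))) ⟩
    + 2 * (1ℤ + (+ N + + j))                      ≡⟨ rearrange (+ N) (+ j) ⟩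
    (+ 4 * + N + + 3) - (1ℤ + + 2 * (+ N - + j))  ≡⟨ cong₂ (λ a d → a - (1ℤ + + 2 * d)) 4N+3 (ℤ.m-n≡m⊖n N j) ⟩
    + (4 ℕ.* N ℕ.+ 3) - odd N j                   ∎
    where
    4N+3 : + 4 * + N + + 3 ≡ + (4 ℕ.* N ℕ.+ 3)
    4N+3 = trans (cong (_+ + 3) (sym (ℤ.pos-* 4 N))) (sym (ℤ.pos-+ (4 ℕ.* N) 3))
    rearrange : ∀ N j → + 2 * (1ℤ + (N + j)) ≡ (+ 4 * N + + 3) - (1ℤ + + 2 * (N - j))
    rearrange = solve-∀

  -- The factors 2, 4, …, 2m of 2ᵐ m! are the even numbers up to 2N, followed by p − o for the
  -- odd numbers o = 2N + 1, 2N - 1, …, 1.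
  2^m*m!≡evens*∏[p-odd] : ∀ N → let m = suc (N ℕ.+ N) in
    (+ 2) ^ m * factorial m ≡ evens N * ∏ (suc N) (λ j → + (4 ℕ.* N ℕ.+ 3) - odd N j)
  2^m*m!≡evens*∏[p-odd] N = begin
    (+ 2) ^ m * factorial m                   ≡⟨ cong (_* factorial m) (∏-const m (+ 2)) ⟨
    ∏ m (λ _ → + 2) * factorial m             ≡⟨ ∏-* m (λ _ → + 2) (λ k → + suc k) ⟨
    ∏ m (λ k → + 2 * + suc k)                 ≡⟨ cong (λ k → evens k) (ℕ.+-suc N N) ⟨
    evens (N ℕ.+ suc N)                       ≡⟨ ∏-+ N (suc N) _ ⟩
    evens N * ∏ (suc N) (λ j → + 2 * + suc (N ℕ.+ j))
                                              ≡⟨ cong (evens N *_) (∏-cong (suc N) (2[N+1+j]≡[4N+3]-odd N)) ⟩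
    evens N * ∏ (suc N) (λ j → + (4 ℕ.* N ℕ.+ 3) - odd N j) ∎
    where m : ℕ
          m = suc (N ℕ.+ N)

  2^m*m!≡[-1]^[N+1]*m! : ∀ N → let m = suc (N ℕ.+ N) in
    + (4 ℕ.* N ℕ.+ 3) ∣ (+ 2) ^ m * factorial m - -1ℤ ^ suc N * factorial m
  2^m*m!≡[-1]^[N+1]*m! N = subst (P ∣_) (sym difference)
    (∣n⇒∣m*n (evens N) (∏-cong-mod (suc N) {λ j → P - odd N j} {λ j → -1ℤ * odd N j} P∣diff))
    where
    m : ℕ
    m = suc (N ℕ.+ N)
    P : ℤ
    P = + (4 ℕ.* N ℕ.+ 3)
    P∣diff : ∀ j → P ∣ (P - odd N j) - (-1ℤ * odd N j)
    P∣diff j = subst (P ∣_) (sym (cancel P (odd N j))) ∣-refl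
      where cancel : ∀ P o → (P - o) - (-1ℤ * o) ≡ P
            cancel = solve-∀
    difference : (+ 2) ^ m * factorial m - -1ℤ ^ suc N * factorial m
               ≡ evens N * (∏ (suc N) (λ j → P - odd N j) - ∏ (suc N) (λ j → -1ℤ * odd N j))
    difference = begin
      (+ 2) ^ m * factorial m - -1ℤ ^ suc N * factorial m
        ≡⟨ cong₂ (λ a b → a - -1ℤ ^ suc N * b) (2^m*m!≡evens*∏[p-odd] N) (factorial-odd N) ⟩
      evens N * ∏ (suc N) (λ j → P - odd N j) - -1ℤ ^ suc N * (evens N * odds N)
        ≡⟨ factor (evens N) _ (-1ℤ ^ suc N) (odds N) ⟩
      evens N * (∏ (suc N) (λ j → P - odd N j) - -1ℤ ^ suc N * odds N)
        ≡⟨ cong (λ b → evens N * (∏ (suc N) (λ j → P - odd N j) - b))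
                (trans (∏-* (suc N) (λ _ → -1ℤ) (odd N)) (cong (_* odds N) (∏-const (suc N) -1ℤ))) ⟨
      evens N * (∏ (suc N) (λ j → P - odd N j) - ∏ (suc N) (λ j → -1ℤ * odd N j)) ∎
      where factor : ∀ E H s O → E * H - s * (E * O) ≡ E * (H - s * O)
            factor = solve-∀

  [-1]^odd : ∀ t → -1ℤ ^ suc (t ℕ.+ t) ≡ -1ℤ
  [-1]^odd zero    = refl
  [-1]^odd (suc t) = begin
    -1ℤ * (-1ℤ * -1ℤ ^ (t ℕ.+ suc t))   ≡⟨ cong (λ k → -1ℤ * (-1ℤ * -1ℤ ^ k)) (ℕ.+-suc t t) ⟩
    -1ℤ * (-1ℤ * -1ℤ ^ suc (t ℕ.+ t))   ≡⟨ cong (λ x → -1ℤ * (-1ℤ * x)) ([-1]^odd t) ⟩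
    -1ℤ                                 ∎

  p∣2^m+1 : ∀ {p} t → Prime p → let N = t ℕ.+ t in p ≡ 4 ℕ.* N ℕ.+ 3 → + p ∣ (+ 2) ^ suc (N ℕ.+ N) + 1ℤ
  p∣2^m+1 {p} t prime-p refl = from-euclid (prime-∣-* _ (factorial m) prime-p p∣[2^m+1]m!)
    where
    N m : ℕ
    N = t ℕ.+ t
    m = suc (N ℕ.+ N)
    p∣[2^m+1]m! : + p ∣ ((+ 2) ^ m + 1ℤ) * factorial m
    p∣[2^m+1]m! = subst (+ p ∣_) (trans (cong (λ s → (+ 2) ^ m * factorial m - s * factorial m) ([-1]^odd t))
                                        (factor ((+ 2) ^ m) (factorial m)))
                    (2^m*m!≡[-1]^[N+1]*m! N)
      where factor : ∀ a f → a * f - -1ℤ * f ≡ (a + 1ℤ) * f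
            factor = solve-∀
    m<p : m ℕ.< p
    m<p = subst (suc m ℕ.≤_) (regroup N) (ℕ.m≤m+n (suc m) (N ℕ.+ N ℕ.+ 1))
      where regroup : ∀ N → suc (suc (N ℕ.+ N)) ℕ.+ (N ℕ.+ N ℕ.+ 1) ≡ 4 ℕ.* N ℕ.+ 3
            regroup = ℕ-Solver.solve-∀
    from-euclid : + p ∣ (+ 2) ^ m + 1ℤ ⊎ + p ∣ factorial m → + p ∣ (+ 2) ^ m + 1ℤ
    from-euclid (inj₁ p∣2^m+1) = p∣2^m+1
    from-euclid (inj₂ p∣m!)    = contradiction p∣m! (prime∤factorial m prime-p m<p)

  p%8≡3⇒p∣x²+2 : ∀ {p} → Prime p → p % 8 ≡ 3 → ∃[ x ] + p ∣ x * x + + 2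
  p%8≡3⇒p∣x²+2 {p} prime-p p≡3 =
    (+ 2) ^ suc N , subst (+ p ∣_) (sym x²+2≡2[2^m+1]) (∣n⇒∣m*n (+ 2) (p∣2^m+1 t prime-p p≡4N+3))
    where
    t N m : ℕ
    t = p / 8
    N = t ℕ.+ t
    m = suc (N ℕ.+ N)
    p≡4N+3 : p ≡ 4 ℕ.* N ℕ.+ 3
    p≡4N+3 = begin
      p                  ≡⟨ m≡m%n+[m/n]*n p 8 ⟩
      p % 8 ℕ.+ t ℕ.* 8  ≡⟨ cong (ℕ._+ t ℕ.* 8) p≡3 ⟩
      3 ℕ.+ t ℕ.* 8      ≡⟨ regroup t ⟩
      4 ℕ.* N ℕ.+ 3      ∎
      where regroup : ∀ t → 3 ℕ.+ t ℕ.* 8 ≡ 4 ℕ.* (t ℕ.+ t) ℕ.+ 3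
            regroup = ℕ-Solver.solve-∀
    x²+2≡2[2^m+1] : (+ 2) ^ suc N * (+ 2) ^ suc N + + 2 ≡ + 2 * ((+ 2) ^ m + 1ℤ)
    x²+2≡2[2^m+1] = begin
      (+ 2) ^ suc N * (+ 2) ^ suc N + + 2  ≡⟨ cong (_+ + 2) (sym (ℤ.^-distribˡ-+-* (+ 2) (suc N) (suc N))) ⟩
      (+ 2) ^ (suc N ℕ.+ suc N) + + 2      ≡⟨ cong (λ k → (+ 2) ^ suc k + + 2) (ℕ.+-suc N N) ⟩
      + 2 * (+ 2) ^ m + + 2                ≡⟨ distrib ((+ 2) ^ m) ⟩
      + 2 * ((+ 2) ^ m + 1ℤ)               ∎
      where distrib : ∀ a → + 2 * a + + 2 ≡ + 2 * (a + 1ℤ)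
            distrib = solve-∀

  -- Thue's lemma

  %ℕ-≡⇒∣- : ∀ a b n .{{_ : ℕ.NonZero n}} → a ℤ.%ℕ n ≡ b ℤ.%ℕ n → + n ∣ a - b
  %ℕ-≡⇒∣- a b n eq = divides (q - q′) (begin
    a - b                                  ≡⟨ cong₂ _-_ (DM.a≡a%ℕn+[a/ℕn]*n a n) (DM.a≡a%ℕn+[a/ℕn]*n b n) ⟩
    + (a ℤ.%ℕ n) + q * + n - (+ (b ℤ.%ℕ n) + q′ * + n)
                                           ≡⟨ cong (λ r → + (a ℤ.%ℕ n) + q * + n - (+ r + q′ * + n)) eq ⟨
    + (a ℤ.%ℕ n) + q * + n - (+ (a ℤ.%ℕ n) + q′ * + n)
                                           ≡⟨ cancel (+ (a ℤ.%ℕ n)) q q′ (+ n) ⟩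
    (q - q′) * + n                         ∎)
    where
    q q′ : ℤ
    q  = a ℤ./ℕ n
    q′ = b ℤ./ℕ n
    cancel : ∀ r q q′ n → r + q * n - (r + q′ * n) ≡ (q - q′) * n
    cancel = solve-∀

  ∣[+m]-[+n]∣≤ : ∀ {m n s} → m ℕ.≤ s → n ℕ.≤ s → ℤ.∣ + m - + n ∣ ℕ.≤ s
  ∣[+m]-[+n]∣≤ {m} {n} m≤s n≤s = subst (ℕ._≤ _) (cong ℤ.∣_∣ (sym (ℤ.m-n≡m⊖n m n)))
                                   (ℕ.≤-trans (ℤ.∣m⊝n∣≤m⊔n m n) (ℕ.⊔-lub m≤s n≤s))

  thue : ∀ n s (x : ℤ) .{{_ : ℕ.NonZero n}} → n ℕ.< suc s ℕ.* suc s →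
         ∃[ u ] ∃[ v ] ¬ (u ≡ 0ℤ × v ≡ 0ℤ) × ℤ.∣ u ∣ ℕ.≤ s × ℤ.∣ v ∣ ℕ.≤ s × + n ∣ u + x * v
  thue n s x n<S² =
    + a i - + a j , + b i - + b j , i≢j , ∣[+m]-[+n]∣≤ (a≤s i) (a≤s j) , ∣[+m]-[+n]∣≤ (b≤s i) (b≤s j) ,
    subst (+ n ∣_) (regroup (+ a i) (+ b i) (+ a j) (+ b j) x) (%ℕ-≡⇒∣- (value i) (value j) n same-residue)
    where
    S : ℕ
    S = suc s
    a b : Fin (S ℕ.* S) → ℕ
    a k = toℕ (proj₁ (remQuot {S} S k))
    b k = toℕ (proj₂ (remQuot {S} S k))
    a≤s : ∀ k → a k ℕ.≤ s
    b≤s : ∀ k → b k ℕ.≤ s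
    a≤s k = ℕ.s≤s⁻¹ (toℕ<n (proj₁ (remQuot {S} S k)))
    b≤s k = ℕ.s≤s⁻¹ (toℕ<n (proj₂ (remQuot {S} S k)))
    value : Fin (S ℕ.* S) → ℤ
    value k = + a k + x * + b k
    residue : Fin (S ℕ.* S) → Fin n
    residue k = fromℕ< (DM.n%ℕd<d (value k) n)
    collision : ∃₂ λ i j → i Fin.< j × residue i ≡ residue j
    collision = pigeonhole n<S² residue
    i j : Fin (S ℕ.* S)
    i = proj₁ collision
    j = proj₁ (proj₂ collision)
    same-residue : value i ℤ.%ℕ n ≡ value j ℤ.%ℕ n
    same-residue = begin
      value i ℤ.%ℕ n               ≡⟨ toℕ-fromℕ< _ ⟨
      toℕ (residue i)              ≡⟨ cong toℕ (proj₂ (proj₂ (proj₂ collision))) ⟩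
      toℕ (residue j)              ≡⟨ toℕ-fromℕ< _ ⟩
      value j ℤ.%ℕ n               ∎
    i≢j : ¬ (+ a i - + a j ≡ 0ℤ × + b i - + b j ≡ 0ℤ)
    i≢j (u≡0 , v≡0) = <-irrefl i≡j (proj₁ (proj₂ (proj₂ collision)))
      where
      coordinate-≡ : ∀ {c d} → + c - + d ≡ 0ℤ → c ≡ d
      coordinate-≡ = ℤ.+-injective ∘ ℤ.i-j≡0⇒i≡j _ _
      same-coordinates : remQuot {S} S i ≡ remQuot {S} S j
      same-coordinates = ×-≡,≡→≡ (toℕ-injective (coordinate-≡ u≡0) , toℕ-injective (coordinate-≡ v≡0))
      i≡j : i ≡ j
      i≡j = begin
        i                                  ≡⟨ combine-remQuot {S} S i ⟨
        uncurry combine (remQuot {S} S i)  ≡⟨ cong (uncurry combine) same-coordinates ⟩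
        uncurry combine (remQuot {S} S j)  ≡⟨ combine-remQuot {S} S j ⟩
        j                                  ∎
    regroup : ∀ ai bi aj bj x → (ai + x * bi) - (aj + x * bj) ≡ (ai - aj) + x * (bi - bj)
    regroup = solve-∀

  i*i≡+∣i∣*∣i∣ : ∀ i → i * i ≡ + (ℤ.∣ i ∣ ℕ.* ℤ.∣ i ∣)
  i*i≡+∣i∣*∣i∣ (+ n)    = sym (ℤ.pos-* n n)
  i*i≡+∣i∣*∣i∣ -[1+ n ] = refl

  short-solution⇒p≡a²+2b² : ∀ {p s} x u v → s ℕ.* s ℕ.< p → ¬ (u ≡ 0ℤ × v ≡ 0ℤ) →
                            ℤ.∣ u ∣ ℕ.≤ s → ℤ.∣ v ∣ ℕ.≤ s → + p ∣ u + x * v → + p ∣ x * x + + 2 →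
                            ∃[ a ] ∃[ b ] a ℕ.* a ℕ.+ 2 ℕ.* (b ℕ.* b) ≡ p
  short-solution⇒p≡a²+2b² {p} x u v s²<p uv≢0 ∣u∣≤s ∣v∣≤s p∣u+xv p∣x²+2 =
    small-multiple⇒p≡c²+2d² s²<p ∣u∣≤s ∣v∣≤s (∣⇒∣ᵤ p∣n) n≢0
    where
    a² b² n : ℕ
    a² = ℤ.∣ u ∣ ℕ.* ℤ.∣ u ∣
    b² = ℤ.∣ v ∣ ℕ.* ℤ.∣ v ∣
    n = a² ℕ.+ 2 ℕ.* b²
    u²+2v²≡n : u * u + + 2 * (v * v) ≡ + n
    u²+2v²≡n = begin
      u * u + + 2 * (v * v)      ≡⟨ cong₂ (λ a b → a + + 2 * b) (i*i≡+∣i∣*∣i∣ u) (i*i≡+∣i∣*∣i∣ v) ⟩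
      + a² + + 2 * + b²          ≡⟨ cong (λ z → + a² + z) (ℤ.pos-* 2 b²) ⟨
      + a² + + (2 ℕ.* b²)        ≡⟨ ℤ.pos-+ a² (2 ℕ.* b²) ⟨
      + n                        ∎
    p∣n : + p ∣ + n
    p∣n = subst (+ p ∣_) (trans (factor u v x) u²+2v²≡n)
            (∣m∣n⇒∣m+n (∣m⇒∣m*n (u - x * v) p∣u+xv) (∣m⇒∣m*n (v * v) p∣x²+2))
      where factor : ∀ u v x → (u + x * v) * (u - x * v) + (x * x + + 2) * (v * v) ≡ u * u + + 2 * (v * v)
            factor = solve-∀
    n≢0 : n ≢ 0
    n≢0 n≡0 = uv≢0 (ℤ.∣i∣≡0⇒i≡0 (proj₁ u,v≡0) , ℤ.∣i∣≡0⇒i≡0 (proj₂ u,v≡0))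
      where u,v≡0 : ℤ.∣ u ∣ ≡ 0 × ℤ.∣ v ∣ ≡ 0
            u,v≡0 = a²+2b²≡0⇒a≡0∧b≡0 ℤ.∣ u ∣ ℤ.∣ v ∣ n≡0

  p∣x²+2⇒p≡a²+2b² : ∀ {p} x → Prime p → + p ∣ x * x + + 2 →
                    ∃[ a ] ∃[ b ] a ℕ.* a ℕ.+ 2 ℕ.* (b ℕ.* b) ≡ p
  p∣x²+2⇒p≡a²+2b² {p} x prime-p p∣x²+2 =
    let s , s²≤p , p<S² = floor-sqrt p
        u , v , uv≢0 , ∣u∣≤s , ∣v∣≤s , p∣u+xv = thue p s x {{prime⇒nonZero prime-p}} p<S²
        s²<p = ℕ.≤∧≢⇒< s²≤p (prime⇒¬square s prime-p)
    in  short-solution⇒p≡a²+2b² x u v s²<p uv≢0 ∣u∣≤s ∣v∣≤s p∣u+xv p∣x²+2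

  𝒫₃ 𝒫₁ : ℕ → HZ → Set
  𝒫₃ p π = Primitive π × norm π ≡ + p × (c0 π > 0ℤ ⊎ (c0 π ≡ 0ℤ × c1 π > 0ℤ)) × π ≡₂ ijk
  𝒫₁ p π = Primitive π × norm π ≡ + p × c0 π > 0ℤ × π ≡₂ one

  InP-cases : ∀ p π → InP p π → (p % 4 ≡ 3 × 𝒫₃ p π) ⊎ (p % 4 ≢ 3 × 𝒫₁ p π)
  InP-cases p π π∈𝒫 with p % 4
  ... | 0 = inj₂ ((λ ()) , π∈𝒫)
  ... | 1 = inj₂ ((λ ()) , π∈𝒫)
  ... | 2 = inj₂ ((λ ()) , π∈𝒫)
  ... | 3 = inj₁ (refl , π∈𝒫)
  ... | suc (suc (suc (suc _))) = inj₂ ((λ ()) , π∈𝒫)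

  𝒫₃⇒InP : ∀ p π → p % 4 ≡ 3 → 𝒫₃ p π → InP p π
  𝒫₃⇒InP p π p≡3 π∈𝒫₃ with p % 4
  𝒫₃⇒InP p π refl π∈𝒫₃ | .3 = π∈𝒫₃

  𝒫₁⇒InP : ∀ p π → p % 4 ≢ 3 → 𝒫₁ p π → InP p π
  𝒫₁⇒InP p π p≢3 π∈𝒫₁ with p % 4
  ... | 0 = π∈𝒫₁
  ... | 1 = π∈𝒫₁
  ... | 2 = π∈𝒫₁
  ... | 3 = contradiction refl p≢3
  ... | suc (suc (suc (suc _))) = π∈𝒫₁

  normℕ : HZ → ℕ
  normℕ (quat a b c d) =
    ℤ.∣ a ∣ ℕ.* ℤ.∣ a ∣ ℕ.+ ℤ.∣ b ∣ ℕ.* ℤ.∣ b ∣ ℕ.+ ℤ.∣ c ∣ ℕ.* ℤ.∣ c ∣ ℕ.+ ℤ.∣ d ∣ ℕ.* ℤ.∣ d ∣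

  norm≡+normℕ : ∀ π → norm π ≡ + normℕ π
  norm≡+normℕ (quat a b c d) = begin
    a * a + b * b + c * c + d * d
      ≡⟨ cong₂ _+_ (cong₂ _+_ (cong₂ _+_ (i*i≡+∣i∣*∣i∣ a) (i*i≡+∣i∣*∣i∣ b)) (i*i≡+∣i∣*∣i∣ c))
                   (i*i≡+∣i∣*∣i∣ d) ⟩
    + A + + B + + C + + D  ≡⟨ cong (λ x → x + + C + + D) (ℤ.pos-+ A B) ⟨
    + (A ℕ.+ B) + + C + + D  ≡⟨ cong (_+ + D) (ℤ.pos-+ (A ℕ.+ B) C) ⟨
    + (A ℕ.+ B ℕ.+ C) + + D  ≡⟨ ℤ.pos-+ (A ℕ.+ B ℕ.+ C) D ⟨
    + (A ℕ.+ B ℕ.+ C ℕ.+ D)  ∎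
    where
    A B C D : ℕ
    A = ℤ.∣ a ∣ ℕ.* ℤ.∣ a ∣
    B = ℤ.∣ b ∣ ℕ.* ℤ.∣ b ∣
    C = ℤ.∣ c ∣ ℕ.* ℤ.∣ c ∣
    D = ℤ.∣ d ∣ ℕ.* ℤ.∣ d ∣

  norm-prime⇒primitive : ∀ {p} π → Prime p → norm π ≡ + p → Primitive π
  norm-prime⇒primitive {p} π@(quat a b c d) prime-p Nπ≡p = cong +_ (G≡1 (prime⇒irreducible prime-p G²∣p))
    where
    G₁ G₂ G : ℕ
    G₁ = ℕ.gcd ℤ.∣ a ∣ ℤ.∣ b ∣
    G₂ = ℕ.gcd G₁ ℤ.∣ c ∣
    G = ℕ.gcd G₂ ℤ.∣ d ∣
    G∣a : G ℕ.∣ ℤ.∣ a ∣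
    G∣a = ℕ.∣-trans (ℕ.gcd[m,n]∣m G₂ _) (ℕ.∣-trans (ℕ.gcd[m,n]∣m G₁ _) (ℕ.gcd[m,n]∣m ℤ.∣ a ∣ _))
    G∣b : G ℕ.∣ ℤ.∣ b ∣
    G∣b = ℕ.∣-trans (ℕ.gcd[m,n]∣m G₂ _) (ℕ.∣-trans (ℕ.gcd[m,n]∣m G₁ _) (ℕ.gcd[m,n]∣n ℤ.∣ a ∣ _))
    G∣c : G ℕ.∣ ℤ.∣ c ∣
    G∣c = ℕ.∣-trans (ℕ.gcd[m,n]∣m G₂ _) (ℕ.gcd[m,n]∣n G₁ _)
    G∣d : G ℕ.∣ ℤ.∣ d ∣
    G∣d = ℕ.gcd[m,n]∣n G₂ _
    G²∣p : G ℕ.* G ℕ.∣ p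
    G²∣p = subst (G ℕ.* G ℕ.∣_) (ℤ.+-injective (trans (sym (norm≡+normℕ π)) Nπ≡p))
             (ℕ.∣m∣n⇒∣m+n (ℕ.∣m∣n⇒∣m+n (ℕ.∣m∣n⇒∣m+n (ℕ.*-pres-∣ G∣a G∣a) (ℕ.*-pres-∣ G∣b G∣b))
                                                    (ℕ.*-pres-∣ G∣c G∣c)) (ℕ.*-pres-∣ G∣d G∣d))
    G≡1 : G ℕ.* G ≡ 1 ⊎ G ℕ.* G ≡ p → G ≡ 1
    G≡1 (inj₁ G²≡1) = ℕ.m*n≡1⇒n≡1 G G G²≡1
    G≡1 (inj₂ G²≡p) = contradiction G²≡p (prime⇒¬square G prime-p)

  2∣i-1⇒∣i∣%2≡1 : ∀ i → Unsigned._∣_ (+ 2) (i - 1ℤ) → ℤ.∣ i ∣ % 2 ≡ 1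
  2∣i-1⇒∣i∣%2≡1 (+ zero)  2∣1   = contradiction (ℕ.∣1⇒≡1 2∣1) (λ ())
  2∣i-1⇒∣i∣%2≡1 +[1+ n ]  2∣n   = 2∣n⇒[1+n]%2≡1 2∣n
  2∣i-1⇒∣i∣%2≡1 -[1+ n ]  2∣2+n =
    2∣n⇒[1+n]%2≡1 (subst (2 ℕ.∣_) (ℕ.+-identityʳ n) (ℕ.∣m+n∣m⇒∣n 2∣2+n (ℕ.∣-refl {2})))

  odd⇒2∣[+n]-1 : ∀ n → n % 2 ≡ 1 → Unsigned._∣_ (+ 2) (+ n - 1ℤ)
  odd⇒2∣[+n]-1 n n-odd = subst (λ m → Unsigned._∣_ (+ 2) (+ m - 1ℤ)) (sym n≡1+2k) (ℕ.n∣m*n (n / 2))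
    where n≡1+2k : n ≡ suc (n / 2 ℕ.* 2)
          n≡1+2k = trans (m≡m%n+[m/n]*n n 2) (cong (ℕ._+ n / 2 ℕ.* 2) n-odd)

  c0≡0⇒p%8≡3 : ∀ {p} π → InP p π → c0 π ≡ 0ℤ → p % 8 ≡ 3
  c0≡0⇒p%8≡3 {p} π π∈𝒫 π₀≡0 with InP-cases p π π∈𝒫
  ... | inj₂ (_ , _ , _ , π₀>0 , _) = contradiction (subst (_> 0ℤ) π₀≡0 π₀>0) (ℤ.<-irrefl refl)
  c0≡0⇒p%8≡3 {p} (quat _ b c d) π∈𝒫 refl | inj₁ (_ , _ , Nπ≡p , _ , _ , 2∣b-1 , 2∣c-1 , 2∣d-1) =
    subst (λ n → n % 8 ≡ 3) (ℤ.+-injective (trans (sym (norm≡+normℕ (quat 0ℤ b c d))) Nπ≡p))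
      (odd⇒[x²+y²+z²]%8≡3 ℤ.∣ b ∣ ℤ.∣ c ∣ ℤ.∣ d ∣
        (2∣i-1⇒∣i∣%2≡1 b 2∣b-1) (2∣i-1⇒∣i∣%2≡1 c 2∣c-1) (2∣i-1⇒∣i∣%2≡1 d 2∣d-1))

  a²+2b²≡p⇒[0,a,b,b]∈𝒫 : ∀ {p} a b → Prime p → p % 8 ≡ 3 → a ℕ.* a ℕ.+ 2 ℕ.* (b ℕ.* b) ≡ p →
                          InP p (quat 0ℤ (+ a) (+ b) (+ b))
  a²+2b²≡p⇒[0,a,b,b]∈𝒫 {p} a b prime-p p≡3 p≡a²+2b² =
    𝒫₃⇒InP p π p%4≡3 (norm-prime⇒primitive π prime-p Nπ≡p , Nπ≡p , inj₂ (refl , +a>0) , ≡₂ijk)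
    where
    π : HZ
    π = quat 0ℤ (+ a) (+ b) (+ b)
    a,b-odd : a % 2 ≡ 1 × b % 2 ≡ 1
    a,b-odd = [a²+2b²]%8≡3⇒odd a b (trans (cong (_% 8) p≡a²+2b²) p≡3)
    p%4≡3 : p % 4 ≡ 3
    p%4≡3 = trans (sym (m∣n⇒o%n%m≡o%m 4 8 p (ℕ.divides 2 refl))) (cong (_% 4) p≡3)
    Nπ≡p : norm π ≡ + p
    Nπ≡p = trans (norm≡+normℕ π) (cong +_ (trans (regroup a b) p≡a²+2b²))
      where regroup : ∀ a b → a ℕ.* a ℕ.+ b ℕ.* b ℕ.+ b ℕ.* b ≡ a ℕ.* a ℕ.+ 2 ℕ.* (b ℕ.* b)
            regroup = ℕ-Solver.solve-∀
    +a>0 : + a > 0ℤ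
    +a>0 = ℤ.+<+ (ℕ.n≢0⇒n>0 (λ { refl → contradiction (proj₁ a,b-odd) (λ ()) }))
    ≡₂ijk : π ≡₂ ijk
    ≡₂ijk = ℕ._∣0 2 , odd⇒2∣[+n]-1 a (proj₁ a,b-odd) ,
            odd⇒2∣[+n]-1 b (proj₂ a,b-odd) , odd⇒2∣[+n]-1 b (proj₂ a,b-odd)

  p%8≡3⇒∃c0≡0 : ∀ {p} → Prime p → p % 8 ≡ 3 → ∃[ π ] InP p π × c0 π ≡ 0ℤ
  p%8≡3⇒∃c0≡0 {p} prime-p p≡3 =
    let x , p∣x²+2  = p%8≡3⇒p∣x²+2 prime-p p≡3
        a , b , p≡a²+2b² = p∣x²+2⇒p≡a²+2b² x prime-p p∣x²+2
    in  quat 0ℤ (+ a) (+ b) (+ b) , a²+2b²≡p⇒[0,a,b,b]∈𝒫 a b prime-p p≡3 p≡a²+2b² , refl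

  primitive-conj : ∀ π → Primitive π → Primitive (conj π)
  primitive-conj (quat a b c d) π-primitive
    rewrite ℤ.∣-i∣≡∣i∣ b | ℤ.∣-i∣≡∣i∣ c | ℤ.∣-i∣≡∣i∣ d = π-primitive

  norm-conj : ∀ π → norm (conj π) ≡ norm π
  norm-conj (quat a b c d) = squares-of-negatives a b c d
    where squares-of-negatives : ∀ a b c d → a * a + - b * - b + - c * - c + - d * - d ≡ a * a + b * b + c * c + d * d
          squares-of-negatives = solve-∀

  2∣i-j⇒2∣-i-j : ∀ i j → Unsigned._∣_ (+ 2) (i - j) → Unsigned._∣_ (+ 2) (- i - j)
  2∣i-j⇒2∣-i-j i j 2∣i-j = ∣⇒∣ᵤ (subst (+ 2 ∣_) (sym (regroup i j))
    (∣m∣n⇒∣m-n (∣m⇒∣-m (∣ᵤ⇒∣ {+ 2} {i - j} 2∣i-j)) (∣n⇒∣m*n j ∣-refl)))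
    where regroup : ∀ i j → - i - j ≡ - (i - j) - j * + 2
          regroup = solve-∀

  conj-≡₂ : ∀ π ρ → π ≡₂ ρ → conj π ≡₂ ρ
  conj-≡₂ (quat a b c d) (quat a′ b′ c′ d′) (2∣a , 2∣b , 2∣c , 2∣d) =
    2∣a , 2∣i-j⇒2∣-i-j b b′ 2∣b , 2∣i-j⇒2∣-i-j c c′ 2∣c , 2∣i-j⇒2∣-i-j d d′ 2∣d

  c0>0⇒conj∈𝒫 : ∀ p π → InP p π → c0 π > 0ℤ → InP p (conj π)
  c0>0⇒conj∈𝒫 p π π∈𝒫 π₀>0 with InP-cases p π π∈𝒫
  ... | inj₁ (p≡3 , prim , Nπ≡p , _ , π≡ijk) =
    𝒫₃⇒InP p (conj π) p≡3 (primitive-conj π prim , trans (norm-conj π) Nπ≡p , inj₁ π₀>0 , conj-≡₂ π ijk π≡ijk)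
  ... | inj₂ (p≢3 , prim , Nπ≡p , _ , π≡1) =
    𝒫₁⇒InP p (conj π) p≢3 (primitive-conj π prim , trans (norm-conj π) Nπ≡p , π₀>0 , conj-≡₂ π one π≡1)

  InP⇒c0>0⊎c0≡0∧c1>0 : ∀ p π → InP p π → c0 π > 0ℤ ⊎ (c0 π ≡ 0ℤ × c1 π > 0ℤ)
  InP⇒c0>0⊎c0≡0∧c1>0 p π π∈𝒫 with InP-cases p π π∈𝒫
  ... | inj₁ (_ , _ , _ , sign , _)  = sign
  ... | inj₂ (_ , _ , _ , π₀>0 , _) = inj₁ π₀>0

  c0≡0⇒conj∉𝒫 : ∀ p π → InP p π → c0 π ≡ 0ℤ → ¬ InP p (conj π)
  c0≡0⇒conj∉𝒫 p π@(quat _ b _ _) π∈𝒫 refl π̄∈𝒫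
    with InP⇒c0>0⊎c0≡0∧c1>0 p π π∈𝒫 | InP⇒c0>0⊎c0≡0∧c1>0 p (conj π) π̄∈𝒫
  ... | inj₁ 0>0        | _                 = ℤ.<-irrefl refl 0>0
  ... | inj₂ _          | inj₁ 0>0          = ℤ.<-irrefl refl 0>0
  ... | inj₂ (_ , b>0)  | inj₂ (_ , -b>0)   = ℤ.<-asym b>0 (subst (_< 0ℤ) (ℤ.neg-involutive b) (ℤ.neg-mono-< -b>0))

  conj∉𝒫⇒c0≡0 : ∀ p π → InP p π → ¬ InP p (conj π) → c0 π ≡ 0ℤ
  conj∉𝒫⇒c0≡0 p π π∈𝒫 π̄∉𝒫 with InP⇒c0>0⊎c0≡0∧c1>0 p π π∈𝒫
  ... | inj₁ π₀>0      = contradiction (c0>0⇒conj∈𝒫 p π π∈𝒫 π₀>0) π̄∉𝒫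
  ... | inj₂ (π₀≡0 , _) = π₀≡0

proposition2 : (p : ℕ) → Prime p → p ≢ 2 →
    ((∃[ π ] (InP p π × c0 π ≡ 0ℤ)) ⇔ (p % 8 ≡ 3))
    × ((∃[ π ] (InP p π × c0 π ≡ 0ℤ)) ⇔ (∃[ π ] (InP p π × ¬ InP p (conj π))))
proposition2 p prime-p _ =
    mk⇔ (λ (π , π∈𝒫 , π₀≡0) → c0≡0⇒p%8≡3 π π∈𝒫 π₀≡0)
        (p%8≡3⇒∃c0≡0 prime-p)
  , mk⇔ (λ (π , π∈𝒫 , π₀≡0) → π , π∈𝒫 , c0≡0⇒conj∉𝒫 p π π∈𝒫 π₀≡0)
        (λ (π , π∈𝒫 , π̄∉𝒫) → π , π∈𝒫 , conj∉𝒫⇒c0≡0 p π π∈𝒫 π̄∉𝒫)
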